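{- Let $H=(V,E)$ be a $3$-uniform hypergraph containing a copy of $K_4^{(3)}$ with vertex set $S$ (so $|S|=4$ and all four triples in $S$ are hyperedges). Let $G(S)$ be the multigraph on $V\setminus S$ in which the multiplicity of a pair $\{y,z\}\subseteq V\setminus S$ equals the number of vertices $x\in S$ with $\{x,y,z\}\in E$, and let $E'$ be the set of pairs of multiplicity at least $3$ in $G(S)$. (i) If there are four vertices in $V\setminus S$ all six of whose pairs lie in $E'$, at least one of these pairs having multiplicity $4$, then $H$ contains a Fano plane. (ii) If there are five vertices in $V\setminus S$ all ten of whose pairs lie in $E'$, then $H$ contains a Fano plane. (iii) If there are vertices $y_1,y_2,y_3,y_4\in V\setminus S$ such that $\{y_1,y_2\}$ and $\{y_1,y_3\}$ both have multiplicity $4$, $\{y_2,y_3\}$ has multiplicity at least $3$, and the three pairs $\{y_1,y_4\},\{y_2,y_4\},\{y_3,y_4\}$ have, in some order, multiplicities at least $4,3,2$, then $H$ contains a Fano plane. (iv) If there are vertices $y_1,y_2,y_3,y_4\in V\setminus S$ such that $\{y_1,y_2\}$ has multiplicity $4$, $\{y_3,y_4\}$ has multiplicity at least $2$, $\{y_1,y_3\}$ has multiplicity at least $2$, $\{y_2,y_3\}$ has multiplicity $4$, and the remaining pairs $\{y_1,y_4\},\{y_2,y_4\}$ have multiplicity at least $3$, then $H$ contains a Fano plane. (v) If there are vertices $y_1,y_2,y_3,y_4\in V\setminus S$ such that $\{y_1,y_2\}$ and $\{y_1,y_3\}$ have multiplicity $4$, $\{y_2,y_3\}$ has multiplicity at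 least $3$, $\{y_1,y_4\}$ has multiplicity $4$, $\{y_2,y_4\}$ has multiplicity at least $2$ and $\{y_3,y_4\}$ has multiplicity at least $1$, then $H$ contains a Fano plane.
   Context: The Fano plane is the unique linear $3$-uniform hypergraph with $7$ vertices and $7$ hyperedges (any two distinct hyperedges share at most one vertex), the projective plane over the field with two elements. "$H$ contains a Fano plane" means $H$ has a subhypergraph isomorphic to it. $K_4^{(3)}$ is the complete $3$-uniform hypergraph on $4$ vertices. -}

module Defs where

open import Data.Nat using (ℕ; zero; suc; _+_; _≤_)
open import Data.Fin using (Fin; zero; suc; #_)
open import Data.Bool using (Bool; true; false; if_then_else_)
open import Data.Product using (Σ; ∃; ∃-syntax; _×_; _,_)
open import Data.Sum using (_⊎_)
open import Relation.Binary.PropositionalEquality using (_≡_; _≢_)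
open import Function.Definitions using (Injective)

record Hypergraph3 (n : ℕ) : Set where
  field
    edge  : Fin n → Fin n → Fin n → Bool
    sym₁₂ : ∀ x y z → edge x y z ≡ edge y x z
    sym₂₃ : ∀ x y z → edge x y z ≡ edge x z y
    irr   : ∀ x y → edge x x y ≡ false
open Hypergraph3 public

IsEdge : ∀ {n} → Hypergraph3 n → Fin n → Fin n → Fin n → Set
IsEdge H x y z = edge H x y z ≡ true

data FanoLine : Fin 7 → Fin 7 → Fin 7 → Set where
  l₁ : FanoLine (# 0) (# 1) (# 2)
  l₂ : FanoLine (# 0) (# 3) (# 4)
  l₃ : FanoLine (# 0) (# 5) (# 6)
  l₄ : FanoLine (# 1) (# 3) (# 5)
  l₅ : FanoLine (# 1) (# 4) (# 6)
  l₆ : FanoLine (# 2) (# 3) (# 6)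
  l₇ : FanoLine (# 2) (# 4) (# 5)

ContainsFano : ∀ {n} → Hypergraph3 n → Set
ContainsFano {n} H =
  Σ (Fin 7 → Fin n) λ f → Injective _≡_ _≡_ f ×
    (∀ a b c → FanoLine a b c → IsEdge H (f a) (f b) (f c))

IsK4 : ∀ {n} → Hypergraph3 n → (Fin 4 → Fin n) → Set
IsK4 H s = Injective _≡_ _≡_ s ×
  (∀ i j k → i ≢ j → j ≢ k → i ≢ k → IsEdge H (s i) (s j) (s k))

Outside : ∀ {n} → (Fin 4 → Fin n) → Fin n → Set
Outside s y = ∀ i → s i ≢ y

mult : ∀ {n} → Hypergraph3 n → (Fin 4 → Fin n) → Fin n → Fin n → ℕ
mult H s y z = ind (s (# 0)) + ind (s (# 1)) + ind (s (# 2)) + ind (s (# 3))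
  where
    ind : _ → ℕ
    ind x = if edge H x y z then 1 else 0

AtLeast432 : ℕ → ℕ → ℕ → Set
AtLeast432 a b c =
    (4 ≤ a × 3 ≤ b × 2 ≤ c) ⊎ (4 ≤ a × 2 ≤ b × 3 ≤ c)
  ⊎ (3 ≤ a × 4 ≤ b × 2 ≤ c) ⊎ (3 ≤ a × 2 ≤ b × 4 ≤ c)
  ⊎ (2 ≤ a × 4 ≤ b × 3 ≤ c) ⊎ (2 ≤ a × 3 ≤ b × 4 ≤ c)

Distinct4 : ∀ {n} → Fin n → Fin n → Fin n → Fin n → Set
Distinct4 y₁ y₂ y₃ y₄ =
  y₁ ≢ y₂ × y₁ ≢ y₃ × y₁ ≢ y₄ × y₂ ≢ y₃ × y₂ ≢ y₄ × y₃ ≢ y₄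

module _ {n : ℕ} (H : Hypergraph3 n) (s : Fin 4 → Fin n) where
  private m = mult H s

  Part-i : Set
  Part-i = (y : Fin 4 → Fin n) → Injective _≡_ _≡_ y → (∀ i → Outside s (y i)) →
    (∀ i j → i ≢ j → 3 ≤ m (y i) (y j)) →
    (∃[ i ] ∃[ j ] (i ≢ j × m (y i) (y j) ≡ 4)) → ContainsFano H

  Part-ii : Set
  Part-ii = (y : Fin 5 → Fin n) → Injective _≡_ _≡_ y → (∀ i → Outside s (y i)) →
    (∀ i j → i ≢ j → 3 ≤ m (y i) (y j)) → ContainsFano H

  Part-iii : Set
  Part-iii = (y₁ y₂ y₃ y₄ : Fin n) → Distinct4 y₁ y₂ y₃ y₄ →
    Outside s y₁ → Outside s y₂ → Outside s y₃ → Outside s y₄ →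
    m y₁ y₂ ≡ 4 → m y₁ y₃ ≡ 4 → 3 ≤ m y₂ y₃ →
    AtLeast432 (m y₁ y₄) (m y₂ y₄) (m y₃ y₄) → ContainsFano H

  Part-iv : Set
  Part-iv = (y₁ y₂ y₃ y₄ : Fin n) → Distinct4 y₁ y₂ y₃ y₄ →
    Outside s y₁ → Outside s y₂ → Outside s y₃ → Outside s y₄ →
    m y₁ y₂ ≡ 4 → 2 ≤ m y₃ y₄ → 2 ≤ m y₁ y₃ → m y₂ y₃ ≡ 4 →
    3 ≤ m y₁ y₄ → 3 ≤ m y₂ y₄ → ContainsFano H

  Part-v : Set
  Part-v = (y₁ y₂ y₃ y₄ : Fin n) → Distinct4 y₁ y₂ y₃ y₄ →
    Outside s y₁ → Outside s y₂ → Outside s y₃ → Outside s y₄ →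
    m y₁ y₂ ≡ 4 → m y₁ y₃ ≡ 4 → 3 ≤ m y₂ y₃ →
    m y₁ y₄ ≡ 4 → 2 ≤ m y₂ y₄ → 1 ≤ m y₃ y₄ → ContainsFano H

-- A Fano plane is a line {a, b, c} together with four points y₁ … y₄ such that
-- a, b and c cover the three perfect matchings of {y₁, …, y₄}: the other six lines
-- are a y₁ y₂, a y₃ y₄, b y₁ y₃, b y₂ y₄, c y₁ y₄ and c y₂ y₃.  Taking the line
-- inside S, it suffices to pick distinct representatives of the three sets Mₖ ⊆ S
-- of points whose links contain both pairs of the k-th matching.  As
-- |N(e) ∩ N(f)| ≥ |N(e)| + |N(f)| − 4, in (i), (iii), (iv) and (v) these sets have
-- sizes at least 1, 2 and 3 in some order, and a greedy choice succeeds.  In (ii)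
-- a single quadruple may have M₁ = M₂ = M₃ of size 2; a finite search over the
-- links of the ten pairs of five vertices shows that some quadruple escapes this.
module Submission where

open import Data.Bool using (Bool; true; false; T; _∧_; _∨_; if_then_else_)
open import Data.Bool.Properties using (T-∧; T-∨; T-≡)
open import Data.Empty using (⊥-elim)
open import Data.Fin using (Fin; zero; suc)
open import Data.Fin.Patterns using (0F; 1F; 2F; 3F; 4F)
open import Data.Fin.Properties using (any?; _≟_)
open import Data.Fin.Subset using (Subset; _∈_; _∉_; _∩_; _∪_; _-_; ∣_∣; Nonempty; inside; outside)
open import Data.Fin.Subset.Properties using (_∈?_; ∣p∣≤n; p─⊥≡p; p─q⊆p; x∈p∩q⁻)
open import Data.Nat using (ℕ; zero; suc; _+_; _∸_; _≤_; _<_; _≤ᵇ_; s≤s; s≤s⁻¹)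
open import Data.Nat.Properties
  using (≤⇒≤ᵇ; ≤-refl; ≤-trans; ≤-reflexive; n≤1+n; <⇒≤; +-suc; +-comm; +-assoc; +-identityʳ;
         +-mono-≤; m≤n+o⇒m∸n≤o; module ≤-Reasoning)
open import Data.Product using (_×_; _,_; ∃₂; proj₁; proj₂)
import Data.Product as Product
open import Data.Sum using (inj₁; inj₂)
open import Data.Vec using ([]; _∷_; here; there; tabulate; lookup)
open import Data.Vec.Properties using (lookup∘tabulate; []=⇒lookup)
open import Data.Vec.Relation.Unary.All using ([]; _∷_)
open import Data.Vec.Relation.Unary.AllPairs using ([]; _∷_)
open import Data.Vec.Relation.Unary.Unique.Propositional using (Unique)
open import Data.Vec.Relation.Unary.Unique.Propositional.Properties using (lookup-injective)
open import Function using (_∘_)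
open import Function.Bundles using (Equivalence)
open import Function.Definitions using (Injective)
open import Relation.Binary.PropositionalEquality
  using (_≡_; _≢_; refl; sym; trans; cong; subst; ≢-sym; module ≡-Reasoning)
open import Relation.Nullary using (Dec; does; ¬?)
open import Relation.Nullary.Decidable using (isYes≗does; map′; _×-dec_; toWitness)
open import Defs

∣p∩q∣+∣p∪q∣≡∣p∣+∣q∣ : ∀ {n} (p q : Subset n) → ∣ p ∩ q ∣ + ∣ p ∪ q ∣ ≡ ∣ p ∣ + ∣ q ∣
∣p∩q∣+∣p∪q∣≡∣p∣+∣q∣ []            []            = refl
∣p∩q∣+∣p∪q∣≡∣p∣+∣q∣ (inside  ∷ p) (inside  ∷ q) =
  cong suc (trans (+-suc ∣ p ∩ q ∣ ∣ p ∪ q ∣)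
                  (trans (cong suc (∣p∩q∣+∣p∪q∣≡∣p∣+∣q∣ p q)) (sym (+-suc ∣ p ∣ ∣ q ∣))))
∣p∩q∣+∣p∪q∣≡∣p∣+∣q∣ (inside  ∷ p) (outside ∷ q) =
  trans (+-suc ∣ p ∩ q ∣ ∣ p ∪ q ∣) (cong suc (∣p∩q∣+∣p∪q∣≡∣p∣+∣q∣ p q))
∣p∩q∣+∣p∪q∣≡∣p∣+∣q∣ (outside ∷ p) (inside  ∷ q) =
  trans (+-suc ∣ p ∩ q ∣ ∣ p ∪ q ∣)
        (trans (cong suc (∣p∩q∣+∣p∪q∣≡∣p∣+∣q∣ p q)) (sym (+-suc ∣ p ∣ ∣ q ∣)))
∣p∩q∣+∣p∪q∣≡∣p∣+∣q∣ (outside ∷ p) (outside ∷ q) = ∣p∩q∣+∣p∪q∣≡∣p∣+∣q∣ p q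

∣p∩q∣-lower-bound : ∀ {n a b} (p q : Subset n) → a ≤ ∣ p ∣ → b ≤ ∣ q ∣ → a + b ∸ n ≤ ∣ p ∩ q ∣
∣p∩q∣-lower-bound {n} {a} {b} p q a≤∣p∣ b≤∣q∣ = m≤n+o⇒m∸n≤o (a + b) n (begin
  a + b                    ≤⟨ +-mono-≤ a≤∣p∣ b≤∣q∣ ⟩
  ∣ p ∣ + ∣ q ∣            ≡⟨ sym (∣p∩q∣+∣p∪q∣≡∣p∣+∣q∣ p q) ⟩
  ∣ p ∩ q ∣ + ∣ p ∪ q ∣    ≤⟨ +-mono-≤ (≤-refl {∣ p ∩ q ∣}) (∣p∣≤n (p ∪ q)) ⟩
  ∣ p ∩ q ∣ + n            ≡⟨ +-comm ∣ p ∩ q ∣ n ⟩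
  n + ∣ p ∩ q ∣            ∎)
  where open ≤-Reasoning

0<∣p∣⇒Nonempty : ∀ {n} (p : Subset n) → 0 < ∣ p ∣ → Nonempty p
0<∣p∣⇒Nonempty (inside  ∷ p) _     = zero , here
0<∣p∣⇒Nonempty (outside ∷ p) 0<∣p∣ = Product.map suc there (0<∣p∣⇒Nonempty p 0<∣p∣)

x∉p-x : ∀ {n} (p : Subset n) x → x ∉ p - x
x∉p-x (_ ∷ p) (suc x) (there x∈p-x) = x∉p-x p x x∈p-x

x∈p-y⇒x≢y : ∀ {n} {p : Subset n} {x y} → x ∈ p - y → x ≢ y
x∈p-y⇒x≢y {p = p} {x} x∈p-x refl = x∉p-x p x x∈p-x

∣p∣≤1+∣p-x∣ : ∀ {n} (p : Subset n) x → ∣ p ∣ ≤ suc ∣ p - x ∣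
∣p∣≤1+∣p-x∣ (inside  ∷ p) zero    = ≤-reflexive (cong (suc ∘ ∣_∣) (sym (p─⊥≡p p)))
∣p∣≤1+∣p-x∣ (outside ∷ p) zero    = ≤-trans (n≤1+n ∣ p ∣) (≤-reflexive (cong (suc ∘ ∣_∣) (sym (p─⊥≡p p))))
∣p∣≤1+∣p-x∣ (inside  ∷ p) (suc x) = s≤s (∣p∣≤1+∣p-x∣ p x)
∣p∣≤1+∣p-x∣ (outside ∷ p) (suc x) = ∣p∣≤1+∣p-x∣ p x

k<∣p∣⇒k≤∣p-x∣ : ∀ {n k} (p : Subset n) x → k < ∣ p ∣ → k ≤ ∣ p - x ∣
k<∣p∣⇒k≤∣p-x∣ p x k<∣p∣ = s≤s⁻¹ (≤-trans k<∣p∣ (∣p∣≤1+∣p-x∣ p x))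

record Transversal {n} (A B C : Subset n) : Set where
  constructor transversal
  field
    {a b c} : Fin n
    a∈A : a ∈ A
    b∈B : b ∈ B
    c∈C : c ∈ C
    a≢b : a ≢ b
    a≢c : a ≢ c
    b≢c : b ≢ c

transversal-swapˡ : ∀ {n} {A B C : Subset n} → Transversal A B C → Transversal B A C
transversal-swapˡ (transversal a∈A b∈B c∈C a≢b a≢c b≢c) =
  transversal b∈B a∈A c∈C (≢-sym a≢b) b≢c a≢c

transversal-swapʳ : ∀ {n} {A B C : Subset n} → Transversal A B C → Transversal A C B
transversal-swapʳ (transversal a∈A b∈B c∈C a≢b a≢c b≢c) =
  transversal a∈A c∈C b∈B a≢c a≢b (≢-sym b≢c)

greedy-transversal : ∀ {n} {A B C : Subset n} → 1 ≤ ∣ A ∣ → 2 ≤ ∣ B ∣ → 3 ≤ ∣ C ∣ → Transversal A B C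
greedy-transversal {A = A} {B} {C} 1≤∣A∣ 2≤∣B∣ 3≤∣C∣
  with a , a∈A ← 0<∣p∣⇒Nonempty A 1≤∣A∣
  with b , b∈B-a ← 0<∣p∣⇒Nonempty (B - a) (k<∣p∣⇒k≤∣p-x∣ B a 2≤∣B∣)
  with c , c∈C-a-b ← 0<∣p∣⇒Nonempty (C - a - b) (k<∣p∣⇒k≤∣p-x∣ (C - a) b (k<∣p∣⇒k≤∣p-x∣ C a 3≤∣C∣)) =
  transversal a∈A (p─q⊆p B _ b∈B-a) (p─q⊆p C _ c∈C-a)
    (≢-sym (x∈p-y⇒x≢y b∈B-a)) (≢-sym (x∈p-y⇒x≢y c∈C-a)) (≢-sym (x∈p-y⇒x≢y c∈C-a-b))
  where
  c∈C-a : c ∈ C - a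
  c∈C-a = p─q⊆p (C - a) _ c∈C-a-b

transversal? : ∀ {n} (A B C : Subset n) → Dec (Transversal A B C)
transversal? A B C =
  map′ (λ (_ , _ , _ , a∈A , b∈B , c∈C , a≢b , a≢c , b≢c) → transversal a∈A b∈B c∈C a≢b a≢c b≢c)
       (λ (transversal a∈A b∈B c∈C a≢b a≢c b≢c) → _ , _ , _ , a∈A , b∈B , c∈C , a≢b , a≢c , b≢c)
       (any? λ a → any? λ b → any? λ c →
         a ∈? A ×-dec b ∈? B ×-dec c ∈? C ×-dec ¬? (a ≟ b) ×-dec ¬? (a ≟ c) ×-dec ¬? (b ≟ c))

MatchingTransversal : ∀ {m n} → (Fin m → Fin m → Subset n) → Fin m → Fin m → Fin m → Fin m → Set
MatchingTransversal L i j k l = Transversal (L i j ∩ L k l) (L i k ∩ L j l) (L i l ∩ L j k)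

allSubsetsᵇ : ∀ {n} → (Subset n → Bool) → Bool
allSubsetsᵇ {zero}  f = f []
allSubsetsᵇ {suc n} f = allSubsetsᵇ (f ∘ (outside ∷_)) ∧ allSubsetsᵇ (f ∘ (inside ∷_))

allSubsetsᵇ-sound : ∀ {n} (f : Subset n → Bool) → T (allSubsetsᵇ f) → ∀ p → T (f p)
allSubsetsᵇ-sound {zero}  f holds []            = holds
allSubsetsᵇ-sound {suc n} f holds (outside ∷ p) =
  allSubsetsᵇ-sound (f ∘ (outside ∷_)) (proj₁ (Equivalence.to T-∧ holds)) p
allSubsetsᵇ-sound {suc n} f holds (inside  ∷ p) =
  allSubsetsᵇ-sound (f ∘ (inside ∷_)) (proj₂ (Equivalence.to T-∧ holds)) p

-- The searches are opaque so that, when the result is replayed below, T (allLargeᵇ f)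
-- is matched against the search term without unfolding it.
opaque
  allLargeᵇ : (Subset 4 → Bool) → Bool
  allLargeᵇ f = allSubsetsᵇ λ p → if 3 ≤ᵇ ∣ p ∣ then f p else true

  allLargeᵇ-sound : ∀ {f} → T (allLargeᵇ f) → ∀ p → 3 ≤ ∣ p ∣ → T (f p)
  allLargeᵇ-sound {f} holds p 3≤∣p∣ =
    T-if (≤⇒≤ᵇ 3≤∣p∣) (allSubsetsᵇ-sound (λ p → if 3 ≤ᵇ ∣ p ∣ then f p else true) holds p)
    where
    T-if : ∀ {b x} → T b → T (if b then x else true) → T x
    T-if {true} _ x = x

opaque
  transversalᵇ : ∀ {n} → Subset n → Subset n → Subset n → Bool
  transversalᵇ A B C = does (transversal? A B C)

  transversalᵇ-sound : ∀ {n} {A B C : Subset n} → T (transversalᵇ A B C) → Transversal A B C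
  transversalᵇ-sound {A = A} {B} {C} =
    toWitness {a? = transversal? A B C} ∘ subst T (sym (isYes≗does (transversal? A B C)))

-- Pruned search: the links at the fifth vertex are only enumerated when the
-- quadruple 0123 has no transversal.
fivePointᵇ : Bool
fivePointᵇ =
  allLargeᵇ λ p₀₁ → allLargeᵇ λ p₂₃ → allLargeᵇ λ p₀₂ →
  allLargeᵇ λ p₁₃ → allLargeᵇ λ p₀₃ → allLargeᵇ λ p₁₂ →
  transversalᵇ (p₀₁ ∩ p₂₃) (p₀₂ ∩ p₁₃) (p₀₃ ∩ p₁₂) ∨
  (allLargeᵇ λ p₀₄ → allLargeᵇ λ p₁₄ → allLargeᵇ λ p₂₄ → allLargeᵇ λ p₃₄ →
   transversalᵇ (p₀₁ ∩ p₂₄) (p₀₂ ∩ p₁₄) (p₀₄ ∩ p₁₂) ∨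
   transversalᵇ (p₀₁ ∩ p₃₄) (p₀₃ ∩ p₁₄) (p₀₄ ∩ p₁₃) ∨
   transversalᵇ (p₀₂ ∩ p₃₄) (p₀₃ ∩ p₂₄) (p₀₄ ∩ p₂₃) ∨
   transversalᵇ (p₁₂ ∩ p₃₄) (p₁₃ ∩ p₂₄) (p₁₄ ∩ p₂₃))

opaque
  unfolding allLargeᵇ transversalᵇ

  fivePointᵇ≡true : fivePointᵇ ≡ true
  fivePointᵇ≡true = refl

module _ (L : Fin 5 → Fin 5 → Subset 4) (large : ∀ i j → i ≢ j → 3 ≤ ∣ L i j ∣) where

  private
    next : ∀ {f} i j → i ≢ j → T (allLargeᵇ f) → T (f (L i j))
    next i j i≢j holds = allLargeᵇ-sound holds (L i j) (large i j i≢j)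

  fivePoint-matchingTransversal : ∃₂ λ i j → ∃₂ λ k l → Distinct4 i j k l × MatchingTransversal L i j k l
  fivePoint-matchingTransversal
    with Equivalence.to T-∨ (next 1F 2F (λ ()) (next 0F 3F (λ ()) (next 1F 3F (λ ())
           (next 0F 2F (λ ()) (next 2F 3F (λ ()) (next 0F 1F (λ ()) (Equivalence.from T-≡ fivePointᵇ≡true)))))))
  ... | inj₁ t = 0F , 1F , 2F , 3F , ((λ ()) , (λ ()) , (λ ()) , (λ ()) , (λ ()) , (λ ())) , transversalᵇ-sound t
  ... | inj₂ rest
    with Equivalence.to T-∨ (next 3F 4F (λ ()) (next 2F 4F (λ ()) (next 1F 4F (λ ()) (next 0F 4F (λ ()) rest))))
  ... | inj₁ t = 0F , 1F , 2F , 4F , ((λ ()) , (λ ()) , (λ ()) , (λ ()) , (λ ()) , (λ ())) , transversalᵇ-sound t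
  ... | inj₂ rest′ with Equivalence.to T-∨ rest′
  ... | inj₁ t = 0F , 1F , 3F , 4F , ((λ ()) , (λ ()) , (λ ()) , (λ ()) , (λ ()) , (λ ())) , transversalᵇ-sound t
  ... | inj₂ rest″ with Equivalence.to T-∨ rest″
  ... | inj₁ t = 0F , 2F , 3F , 4F , ((λ ()) , (λ ()) , (λ ()) , (λ ()) , (λ ()) , (λ ())) , transversalᵇ-sound t
  ... | inj₂ t = 1F , 2F , 3F , 4F , ((λ ()) , (λ ()) , (λ ()) , (λ ()) , (λ ()) , (λ ())) , transversalᵇ-sound t

line+matchings⇒Fano : ∀ {n} (H : Hypergraph3 n) {a b c y₁ y₂ y₃ y₄ : Fin n} →
  Unique (a ∷ b ∷ c ∷ y₁ ∷ y₂ ∷ y₃ ∷ y₄ ∷ []) → IsEdge H a b c →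
  IsEdge H a y₁ y₂ → IsEdge H a y₃ y₄ →
  IsEdge H b y₁ y₃ → IsEdge H b y₂ y₄ →
  IsEdge H c y₁ y₄ → IsEdge H c y₂ y₃ → ContainsFano H
line+matchings⇒Fano H {a} {b} {c} {y₁} {y₂} {y₃} {y₄} distinct abc a₁₂ a₃₄ b₁₃ b₂₄ c₁₄ c₂₃ =
  lookup points , (λ {i} {j} → lookup-injective distinct i j) , lines
  where
  points = a ∷ b ∷ c ∷ y₁ ∷ y₂ ∷ y₃ ∷ y₄ ∷ []
  lines : ∀ i j k → FanoLine i j k → IsEdge H (lookup points i) (lookup points j) (lookup points k)
  lines _ _ _ l₁ = abc
  lines _ _ _ l₂ = a₁₂
  lines _ _ _ l₃ = a₃₄
  lines _ _ _ l₄ = b₁₃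
  lines _ _ _ l₅ = b₂₄
  lines _ _ _ l₆ = c₁₄
  lines _ _ _ l₇ = c₂₃

Distinct4-map : ∀ {m n} {f : Fin m → Fin n} → Injective _≡_ _≡_ f →
  ∀ {i j k l} → Distinct4 i j k l → Distinct4 (f i) (f j) (f k) (f l)
Distinct4-map f-inj (i≢j , i≢k , i≢l , j≢k , j≢l , k≢l) =
  i≢j ∘ f-inj , i≢k ∘ f-inj , i≢l ∘ f-inj , j≢k ∘ f-inj , j≢l ∘ f-inj , k≢l ∘ f-inj

Distinct4-completion : ∀ {i j : Fin 4} → i ≢ j → ∃₂ λ k l → Distinct4 i j k l
Distinct4-completion {0F} {0F} i≢i = ⊥-elim (i≢i refl)
Distinct4-completion {0F} {1F} _   = 2F , 3F , (λ ()) , (λ ()) , (λ ()) , (λ ()) , (λ ()) , (λ ())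
Distinct4-completion {0F} {2F} _   = 1F , 3F , (λ ()) , (λ ()) , (λ ()) , (λ ()) , (λ ()) , (λ ())
Distinct4-completion {0F} {3F} _   = 1F , 2F , (λ ()) , (λ ()) , (λ ()) , (λ ()) , (λ ()) , (λ ())
Distinct4-completion {1F} {0F} _   = 2F , 3F , (λ ()) , (λ ()) , (λ ()) , (λ ()) , (λ ()) , (λ ())
Distinct4-completion {1F} {1F} i≢i = ⊥-elim (i≢i refl)
Distinct4-completion {1F} {2F} _   = 0F , 3F , (λ ()) , (λ ()) , (λ ()) , (λ ()) , (λ ()) , (λ ())
Distinct4-completion {1F} {3F} _   = 0F , 2F , (λ ()) , (λ ()) , (λ ()) , (λ ()) , (λ ()) , (λ ())
Distinct4-completion {2F} {0F} _   = 1F , 3F , (λ ()) , (λ ()) , (λ ()) , (λ ()) , (λ ()) , (λ ())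
Distinct4-completion {2F} {1F} _   = 0F , 3F , (λ ()) , (λ ()) , (λ ()) , (λ ()) , (λ ()) , (λ ())
Distinct4-completion {2F} {2F} i≢i = ⊥-elim (i≢i refl)
Distinct4-completion {2F} {3F} _   = 0F , 1F , (λ ()) , (λ ()) , (λ ()) , (λ ()) , (λ ()) , (λ ())
Distinct4-completion {3F} {0F} _   = 1F , 2F , (λ ()) , (λ ()) , (λ ()) , (λ ()) , (λ ()) , (λ ())
Distinct4-completion {3F} {1F} _   = 0F , 2F , (λ ()) , (λ ()) , (λ ()) , (λ ()) , (λ ()) , (λ ())
Distinct4-completion {3F} {2F} _   = 0F , 1F , (λ ()) , (λ ()) , (λ ()) , (λ ()) , (λ ()) , (λ ())
Distinct4-completion {3F} {3F} i≢i = ⊥-elim (i≢i refl)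

∣x∷p∣≡ : ∀ {n} b (p : Subset n) → ∣ b ∷ p ∣ ≡ (if b then 1 else 0) + ∣ p ∣
∣x∷p∣≡ true  p = refl
∣x∷p∣≡ false p = refl

module _ {n} (H : Hypergraph3 n) (s : Fin 4 → Fin n) where

  link : Fin n → Fin n → Subset 4
  link y z = tabulate λ x → edge H (s x) y z

  ∈link⇒IsEdge : ∀ {x y z} → x ∈ link y z → IsEdge H (s x) y z
  ∈link⇒IsEdge {x} {y} {z} x∈link =
    trans (sym (lookup∘tabulate (λ x → edge H (s x) y z) x)) ([]=⇒lookup x∈link)

  ∣link∣≡mult : ∀ y z → ∣ link y z ∣ ≡ mult H s y z
  ∣link∣≡mult y z = begin
    ∣ link y z ∣                            ≡⟨ ∣x∷p∣≡ (e 0F) (e 1F ∷ e 2F ∷ e 3F ∷ []) ⟩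
    i 0F + ∣ e 1F ∷ e 2F ∷ e 3F ∷ [] ∣      ≡⟨ cong (i 0F +_) (∣x∷p∣≡ (e 1F) (e 2F ∷ e 3F ∷ [])) ⟩
    i 0F + (i 1F + ∣ e 2F ∷ e 3F ∷ [] ∣)    ≡⟨ cong (λ t → i 0F + (i 1F + t)) (∣x∷p∣≡ (e 2F) (e 3F ∷ [])) ⟩
    i 0F + (i 1F + (i 2F + ∣ e 3F ∷ [] ∣))  ≡⟨ cong (λ t → i 0F + (i 1F + (i 2F + t))) (∣x∷p∣≡ (e 3F) []) ⟩
    i 0F + (i 1F + (i 2F + (i 3F + 0)))     ≡⟨ cong (λ t → i 0F + (i 1F + (i 2F + t))) (+-identityʳ (i 3F)) ⟩
    i 0F + (i 1F + (i 2F + i 3F))           ≡⟨ sym (+-assoc (i 0F) (i 1F) _) ⟩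
    i 0F + i 1F + (i 2F + i 3F)             ≡⟨ sym (+-assoc (i 0F + i 1F) (i 2F) (i 3F)) ⟩
    i 0F + i 1F + i 2F + i 3F               ∎
    where
    open ≡-Reasoning
    e : Fin 4 → Bool
    e x = edge H (s x) y z
    i : Fin 4 → ℕ
    i x = if e x then 1 else 0

  ≤mult⇒≤∣link∣ : ∀ {k y z} → k ≤ mult H s y z → k ≤ ∣ link y z ∣
  ≤mult⇒≤∣link∣ {k} {y} {z} = subst (k ≤_) (sym (∣link∣≡mult y z))

  ∣link∩link∣-lower-bound : ∀ {a b y₁ y₂ y₃ y₄} → a ≤ mult H s y₁ y₂ → b ≤ mult H s y₃ y₄ →
    a + b ∸ 4 ≤ ∣ link y₁ y₂ ∩ link y₃ y₄ ∣
  ∣link∩link∣-lower-bound {y₁ = y₁} {y₂} {y₃} {y₄} a≤m₁₂ b≤m₃₄ =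
    ∣p∩q∣-lower-bound (link y₁ y₂) (link y₃ y₄) (≤mult⇒≤∣link∣ a≤m₁₂) (≤mult⇒≤∣link∣ b≤m₃₄)

  module _ (K₄ : IsK4 H s) where

    MatchingTransversal⇒Fano : ∀ {y₁ y₂ y₃ y₄} → Distinct4 y₁ y₂ y₃ y₄ →
      Outside s y₁ → Outside s y₂ → Outside s y₃ → Outside s y₄ →
      MatchingTransversal link y₁ y₂ y₃ y₄ → ContainsFano H
    MatchingTransversal⇒Fano {y₁} {y₂} {y₃} {y₄}
      (y₁≢y₂ , y₁≢y₃ , y₁≢y₄ , y₂≢y₃ , y₂≢y₄ , y₃≢y₄) o₁ o₂ o₃ o₄
      (transversal {a} {b} {c} a∈M₁ b∈M₂ c∈M₃ a≢b a≢c b≢c) =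
      line+matchings⇒Fano H distinct (proj₂ K₄ a b c a≢b b≢c a≢c)
        (∈link⇒IsEdge (proj₁ a∈)) (∈link⇒IsEdge (proj₂ a∈))
        (∈link⇒IsEdge (proj₁ b∈)) (∈link⇒IsEdge (proj₂ b∈))
        (∈link⇒IsEdge (proj₁ c∈)) (∈link⇒IsEdge (proj₂ c∈))
      where
      s-inj = proj₁ K₄
      a∈ = x∈p∩q⁻ (link y₁ y₂) (link y₃ y₄) a∈M₁
      b∈ = x∈p∩q⁻ (link y₁ y₃) (link y₂ y₄) b∈M₂
      c∈ = x∈p∩q⁻ (link y₁ y₄) (link y₂ y₃) c∈M₃
      distinct : Unique (s a ∷ s b ∷ s c ∷ y₁ ∷ y₂ ∷ y₃ ∷ y₄ ∷ [])
      distinct = (a≢b ∘ s-inj ∷ a≢c ∘ s-inj ∷ o₁ a ∷ o₂ a ∷ o₃ a ∷ o₄ a ∷ [])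
               ∷ (b≢c ∘ s-inj ∷ o₁ b ∷ o₂ b ∷ o₃ b ∷ o₄ b ∷ [])
               ∷ (o₁ c ∷ o₂ c ∷ o₃ c ∷ o₄ c ∷ [])
               ∷ (y₁≢y₂ ∷ y₁≢y₃ ∷ y₁≢y₄ ∷ [])
               ∷ (y₂≢y₃ ∷ y₂≢y₄ ∷ [])
               ∷ (y₃≢y₄ ∷ [])
               ∷ []
               ∷ []

    part-i : Part-i H s
    part-i y y-inj out large (i , j , i≢j , mᵢⱼ≡4)
      with k , l , ijkl@(_ , i≢k , i≢l , j≢k , j≢l , k≢l) ← Distinct4-completion i≢j =
      MatchingTransversal⇒Fano (Distinct4-map y-inj ijkl) (out i) (out j) (out k) (out l)
        (transversal-swapˡ (transversal-swapʳ (greedy-transversal (<⇒≤ M₂) M₃ M₁)))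
      where
      M₁ : 3 ≤ ∣ link (y i) (y j) ∩ link (y k) (y l) ∣
      M₁ = ∣link∩link∣-lower-bound (≤-reflexive (sym mᵢⱼ≡4)) (large k l k≢l)
      M₂ : 2 ≤ ∣ link (y i) (y k) ∩ link (y j) (y l) ∣
      M₂ = ∣link∩link∣-lower-bound (large i k i≢k) (large j l j≢l)
      M₃ : 2 ≤ ∣ link (y i) (y l) ∩ link (y j) (y k) ∣
      M₃ = ∣link∩link∣-lower-bound (large i l i≢l) (large j k j≢k)

    part-ii : Part-ii H s
    part-ii y y-inj out large
      with i , j , k , l , ijkl , t ←
             fivePoint-matchingTransversal (λ i j → link (y i) (y j)) (λ i j → ≤mult⇒≤∣link∣ ∘ large i j) =
      MatchingTransversal⇒Fano (Distinct4-map y-inj ijkl) (out i) (out j) (out k) (out l) t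

    part-iii : Part-iii H s
    part-iii y₁ y₂ y₃ y₄ d o₁ o₂ o₃ o₄ m₁₂≡4 m₁₃≡4 3≤m₂₃ at-least-432 =
      MatchingTransversal⇒Fano d o₁ o₂ o₃ o₄ (by-cases at-least-432)
      where
      M₁ : ∀ {k} → k ≤ mult H s y₃ y₄ → k ≤ ∣ link y₁ y₂ ∩ link y₃ y₄ ∣
      M₁ = ∣link∩link∣-lower-bound (≤-reflexive (sym m₁₂≡4))
      M₂ : ∀ {k} → k ≤ mult H s y₂ y₄ → k ≤ ∣ link y₁ y₃ ∩ link y₂ y₄ ∣
      M₂ = ∣link∩link∣-lower-bound (≤-reflexive (sym m₁₃≡4))
      M₃ : ∀ {k} → k ≤ mult H s y₁ y₄ → k + 3 ∸ 4 ≤ ∣ link y₁ y₄ ∩ link y₂ y₃ ∣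
      M₃ k≤m₁₄ = ∣link∩link∣-lower-bound k≤m₁₄ 3≤m₂₃
      by-cases : AtLeast432 (mult H s y₁ y₄) (mult H s y₂ y₄) (mult H s y₃ y₄) →
        MatchingTransversal link y₁ y₂ y₃ y₄
      by-cases (inj₁ (4≤m₁₄ , 3≤m₂₄ , 2≤m₃₄)) =
        greedy-transversal (<⇒≤ (M₁ 2≤m₃₄)) (<⇒≤ (M₂ 3≤m₂₄)) (M₃ 4≤m₁₄)
      by-cases (inj₂ (inj₁ (4≤m₁₄ , 2≤m₂₄ , 3≤m₃₄))) =
        greedy-transversal (<⇒≤ (<⇒≤ (M₁ 3≤m₃₄))) (M₂ 2≤m₂₄) (M₃ 4≤m₁₄)
      by-cases (inj₂ (inj₂ (inj₁ (3≤m₁₄ , 4≤m₂₄ , 2≤m₃₄)))) = transversal-swapʳ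
        (greedy-transversal (<⇒≤ (M₁ 2≤m₃₄)) (M₃ 3≤m₁₄) (<⇒≤ (M₂ 4≤m₂₄)))
      by-cases (inj₂ (inj₂ (inj₂ (inj₁ (3≤m₁₄ , 2≤m₂₄ , 4≤m₃₄))))) = transversal-swapˡ (transversal-swapʳ
        (greedy-transversal (<⇒≤ (M₂ 2≤m₂₄)) (M₃ 3≤m₁₄) (<⇒≤ (M₁ 4≤m₃₄))))
      by-cases (inj₂ (inj₂ (inj₂ (inj₂ (inj₁ (2≤m₁₄ , 4≤m₂₄ , 3≤m₃₄)))))) = transversal-swapʳ (transversal-swapˡ
        (greedy-transversal (M₃ 2≤m₁₄) (<⇒≤ (M₁ 3≤m₃₄)) (<⇒≤ (M₂ 4≤m₂₄))))
      by-cases (inj₂ (inj₂ (inj₂ (inj₂ (inj₂ (2≤m₁₄ , 3≤m₂₄ , 4≤m₃₄)))))) =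
        transversal-swapˡ (transversal-swapʳ (transversal-swapˡ
          (greedy-transversal (M₃ 2≤m₁₄) (<⇒≤ (M₂ 3≤m₂₄)) (<⇒≤ (M₁ 4≤m₃₄)))))

    part-iv : Part-iv H s
    part-iv y₁ y₂ y₃ y₄ d o₁ o₂ o₃ o₄ m₁₂≡4 2≤m₃₄ 2≤m₁₃ m₂₃≡4 3≤m₁₄ 3≤m₂₄ =
      MatchingTransversal⇒Fano d o₁ o₂ o₃ o₄ (transversal-swapˡ (greedy-transversal
        (∣link∩link∣-lower-bound 2≤m₁₃ 3≤m₂₄)
        (∣link∩link∣-lower-bound (≤-reflexive (sym m₁₂≡4)) 2≤m₃₄)
        (∣link∩link∣-lower-bound 3≤m₁₄ (≤-reflexive (sym m₂₃≡4)))))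

    part-v : Part-v H s
    part-v y₁ y₂ y₃ y₄ d o₁ o₂ o₃ o₄ m₁₂≡4 m₁₃≡4 3≤m₂₃ m₁₄≡4 2≤m₂₄ 1≤m₃₄ =
      MatchingTransversal⇒Fano d o₁ o₂ o₃ o₄ (greedy-transversal
        (∣link∩link∣-lower-bound (≤-reflexive (sym m₁₂≡4)) 1≤m₃₄)
        (∣link∩link∣-lower-bound (≤-reflexive (sym m₁₃≡4)) 2≤m₂₄)
        (∣link∩link∣-lower-bound (≤-reflexive (sym m₁₄≡4)) 3≤m₂₃))

lemma2p5 : ∀ {n : ℕ} (H : Hypergraph3 n) (s : Fin 4 → Fin n) → IsK4 H s →
    Part-i H s × Part-ii H s × Part-iii H s × Part-iv H s × Part-v H s
lemma2p5 H s K₄ = part-i H s K₄ , part-ii H s K₄ , part-iii H s K₄ , part-iv H s K₄ , part-v H s K₄
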